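{- For every $n\geq 2$, the tree $T_n$ has exactly $n-1$ vertices, of which exactly $\lfloor n/2\rfloor$ are skew-symmetric and exactly $\lfloor (n-1)/2\rfloor$ are symmetric.
   Context: Definition of $\boldsymbol{w}(k)$ for integers $k\geq 2$: $\boldsymbol{w}(k)=(w(k)_0,\dots,w(k)_{k-1})$, where: if $k$ is odd, $w(k)_i=(k-1)/2$ for $i$ even and $w(k)_i=-(k+1)/2$ for $i$ odd; $\boldsymbol{w}(2)=(1,-1)$; $\boldsymbol{w}(4)=(1,-1,-1,1)$; if $k=2m$ is even with $k>4$, $w(k)_i=w(m)_{i \bmod m}$ for $0\le i\le k-1$. (E.g. $\boldsymbol{w}(3)=(1,-2,1)$, $\boldsymbol{w}(6)=(1,-2,1,1,-2,1)$.) The tree $T_n$ ($n\ge2$): a rooted, vector-labeled binary tree. The root is labeled $\boldsymbol{w}(n)\in\mathbb{R}^n$ (coordinates indexed $0,\dots,n-1$). For a vertex with label $\boldsymbol{u}=(u_0,\dots,u_{n-1})$, let $i_0<\dots<i_{a'-1}$ be the indices $i$ with $u_i>0$ and $j_0<\dots<j_{a''-1}$ those with $u_j<0$. If $a'\ge2$, the vertex gets a left child labeled $\boldsymbol{u}'$ with $u'_{i_r}=w(a')_r$ ($0\le r\le a'-1$) and $u'_i=0$ otherwise. If $a''\ge 2$, it gets a right child labeled $\boldsymbol{u}''$ with $u''_{j_r}=w(a'')_r$ and $u''_i=0$ otherwise. If $a'=a''=1$ the vertex is a leaf. A vertex is called skew-symmetric if the sequence of nonzero entries of its label (read in order of index)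 equals $\boldsymbol{w}(2)=(1,-1)$; otherwise it is called symmetric. -}

module Defs where

open import Data.Nat using (ℕ; zero; suc; _+_; _*_; _∸_; _/_; _%_; _≡ᵇ_)
open import Data.Integer using (ℤ; +_; -_; 0ℤ; _<?_)
open import Data.List using (List; []; _∷_; _++_; length; filter; upTo; map)
open import Data.Maybe using (Maybe; just; nothing)
open import Data.Bool using (Bool; true; false; if_then_else_)
open import Relation.Nullary using (does)
open import Relation.Nullary.Decidable using (¬?)
open import Relation.Binary.PropositionalEquality using (_≡_)
import Data.Integer.Properties as ℤP

-- Labels are lists of integers (coordinates indexed 0..n-1 in list order).

wOdd : ℕ → List ℤ
wOdd k = map (λ i → if (i % 2) ≡ᵇ 0 then + ((k ∸ 1) / 2) else - (+ ((k + 1) / 2))) (upTo k)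

-- w with a fuel argument (k halves at each recursive call, so fuel k suffices).
wF : ℕ → ℕ → List ℤ
wF zero    k = []
wF (suc f) k with k % 2 ≡ᵇ 1
... | true  = wOdd k
... | false with k
...   | 2 = + 1 ∷ - (+ 1) ∷ []
...   | 4 = + 1 ∷ - (+ 1) ∷ - (+ 1) ∷ + 1 ∷ []
...   | k' = wF f (k' / 2) ++ wF f (k' / 2)

-- w(k) for k ≥ 2 (the value for k < 2 is irrelevant and never used).
w : ℕ → List ℤ
w k = wF k k

isPos : ℤ → Bool
isPos x = does (0ℤ <? x)

isNeg : ℤ → Bool
isNeg x = does (x <? 0ℤ)

relabel : (ℤ → Bool) → List ℤ → List ℤ → List ℤ
relabel p []       ws = []
relabel p (x ∷ xs) ws with p x
relabel p (x ∷ xs) [] | true = 0ℤ ∷ relabel p xs []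
relabel p (x ∷ xs) (v ∷ ws) | true = v ∷ relabel p xs ws
... | false = 0ℤ ∷ relabel p xs ws

countBy : (ℤ → Bool) → List ℤ → ℕ
countBy p []       = 0
countBy p (x ∷ xs) = (if p x then 1 else 0) + countBy p xs

data Tree : Set where
  node : List ℤ → Maybe Tree → Maybe Tree → Tree

-- Build the subtree rooted at a vertex labelled u, with fuel.
-- (The number of nonzero entries strictly decreases from parent to child and
--  the root w(n) has n nonzero entries, so fuel n is enough.)
build : ℕ → List ℤ → Tree
build zero    u = node u nothing nothing
build (suc f) u = node u left right
  where
  a' = countBy isPos u
  a'' = countBy isNeg u
  left : Maybe Tree
  left with 2 Data.Nat.≤ᵇ a'
  ... | true  = just (build f (relabel isPos u (w a')))
  ... | false = nothing
  right : Maybe Tree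
  right with 2 Data.Nat.≤ᵇ a''
  ... | true  = just (build f (relabel isNeg u (w a'')))
  ... | false = nothing

T : ℕ → Tree
T n = build n (w n)

nonzeros : List ℤ → List ℤ
nonzeros = filter (λ x → ¬? (x ℤP.≟ 0ℤ))

skewSymmetric? : List ℤ → Bool
skewSymmetric? u with nonzeros u
... | x ∷ y ∷ [] = does (x ℤP.≟ + 1) Data.Bool.∧ does (y ℤP.≟ - (+ 1))
... | _ = false

mutual
  labels : Tree → List (List ℤ)
  labels (node u l r) = u ∷ (labelsM l ++ labelsM r)

  labelsM : Maybe Tree → List (List ℤ)
  labelsM nothing  = []
  labelsM (just t) = labels t

vertices : Tree → ℕ
vertices t = length (labels t)

skewCount : Tree → ℕ
skewCount t = length (filter (λ u → skewSymmetric? u Data.Bool.≟ true) (labels t))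

symCount : Tree → ℕ
symCount t = length (filter (λ u → skewSymmetric? u Data.Bool.≟ false) (labels t))

-- A vertex whose label has nonzero entries w(k) has children labelled by w(p) and
-- w(q), where p and q count the positive and negative entries of w(k); so p + q = k
-- with p, q ≥ 1, and a child is present exactly when its count is at least 2.
-- Moreover ⌊p/2⌋ + ⌊q/2⌋ = ⌊k/2⌋ unless w(k) = (1,-1), where p = q = 1: for odd k the
-- counts are consecutive, for even k > 4 both are even.  Induction on k then gives
-- 1 + (p-1) + (q-1) = k - 1 vertices and ⌊k/2⌋ skew-symmetric ones, and the
-- symmetric vertices are the remaining ⌊(k-1)/2⌋.
module Submission where

open import Data.Bool using (Bool; true; false; if_then_else_) renaming (T to True)
import Data.Bool as Bool
open import Data.Integer using (ℤ; +_; -_; 0ℤ; -[1+_])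
import Data.Integer.Properties as ℤ
open import Data.List using (List; []; _∷_; _++_; length; filter; applyUpTo; upTo; map)
open import Data.List.Properties using (filter-accept; filter-reject; filter-all; filter-++; length-++)
open import Data.List.Relation.Unary.All using (All; []; _∷_)
open import Data.List.Relation.Unary.All.Properties using (++⁺)
open import Data.Maybe using (Maybe; just; nothing)
open import Data.Nat using (ℕ; zero; suc; _+_; _*_; _∸_; _/_; _%_; _≡ᵇ_; _≤ᵇ_; _≤_; _<_; z≤n; s≤s; s≤s⁻¹; ⌊_/2⌋; ⌈_/2⌉)
open import Data.Nat.DivMod using (m/n≡1+[m∸n]/n; [m+kn]%n≡m%n; m*n%n≡0)
open import Data.Nat.Properties
open import Data.Product using (_×_; _,_; proj₁; proj₂)
import Data.Product as Product
open import Data.Unit using (tt)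
open import Function using (_∘_)
open import Relation.Binary.PropositionalEquality
open import Relation.Nullary using (yes; no; ¬?; contradiction)
open import Relation.Unary using (Decidable)

open import Defs

nonzero? : Decidable (_≢ 0ℤ)
nonzero? x = ¬? (x ℤ.≟ 0ℤ)

countBy-++ : ∀ P xs ys → countBy P (xs ++ ys) ≡ countBy P xs + countBy P ys
countBy-++ P []       ys = refl
countBy-++ P (x ∷ xs) ys = trans (cong (λ n → _ + n) (countBy-++ P xs ys)) (sym (+-assoc (if P x then 1 else 0) _ _))

countBy-nonzeros : ∀ P → P 0ℤ ≡ false → ∀ u → countBy P (nonzeros u) ≡ countBy P u
countBy-nonzeros P P0≡false []       = refl
countBy-nonzeros P P0≡false (x ∷ xs) with x ℤ.≟ 0ℤ
... | yes refl rewrite P0≡false = countBy-nonzeros P P0≡false xs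
... | no _     = cong (λ n → _ + n) (countBy-nonzeros P P0≡false xs)

countBy-isPos+isNeg : ∀ {xs} → All (_≢ 0ℤ) xs → countBy isPos xs + countBy isNeg xs ≡ length xs
countBy-isPos+isNeg []                        = refl
countBy-isPos+isNeg { + zero ∷ _ } (x≢0 ∷ _) = contradiction refl x≢0
countBy-isPos+isNeg { + suc _ ∷ _ } (_ ∷ xs)  = cong suc (countBy-isPos+isNeg xs)
countBy-isPos+isNeg { -[1+ _ ] ∷ _ } (_ ∷ nz)  = trans (+-suc _ _) (cong suc (countBy-isPos+isNeg nz))

nonzeros-relabel : ∀ P u ws → countBy P u ≡ length ws → All (_≢ 0ℤ) ws → nonzeros (relabel P u ws) ≡ ws
nonzeros-relabel P []       []       _ _ = refl
nonzeros-relabel P (x ∷ xs) ws c nz with P x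
nonzeros-relabel P (x ∷ xs) (v ∷ ws) c (v≢0 ∷ nz) | true =
  trans (filter-accept nonzero? {xs = relabel P xs ws} v≢0) (cong (v ∷_) (nonzeros-relabel P xs ws (suc-injective c) nz))
... | false = trans (filter-reject nonzero? {xs = relabel P xs ws} (λ 0≢0 → 0≢0 refl)) (nonzeros-relabel P xs ws c nz)

length-filter-false+true : ∀ {A : Set} (f : A → Bool) xs →
  length (filter (λ x → f x Bool.≟ false) xs) + length (filter (λ x → f x Bool.≟ true) xs) ≡ length xs
length-filter-false+true f []       = refl
length-filter-false+true f (x ∷ xs) with f x
... | true  = trans (+-suc _ _) (cong suc (length-filter-false+true f xs))
... | false = cong suc (length-filter-false+true f xs)

n/2≡⌊n/2⌋ : ∀ n → n / 2 ≡ ⌊ n /2⌋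
n/2≡⌊n/2⌋ 0             = refl
n/2≡⌊n/2⌋ 1             = refl
n/2≡⌊n/2⌋ (suc (suc n)) = trans (m/n≡1+[m∸n]/n {2 + n} (s≤s (s≤s z≤n))) (cong suc (n/2≡⌊n/2⌋ n))

⌊n*2/2⌋≡n : ∀ n → ⌊ n * 2 /2⌋ ≡ n
⌊n*2/2⌋≡n zero    = refl
⌊n*2/2⌋≡n (suc n) = cong suc (⌊n*2/2⌋≡n n)

⌈n*2/2⌉≡n : ∀ n → ⌈ n * 2 /2⌉ ≡ n
⌈n*2/2⌉≡n zero    = refl
⌈n*2/2⌉≡n (suc n) = cong suc (⌈n*2/2⌉≡n n)

alternate : {A : Set} → A → A → ℕ → List A
alternate x y zero    = []
alternate x y (suc n) = x ∷ alternate y x n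

applyUpTo-periodic : ∀ {A : Set} (f : ℕ → A) → (∀ i → f (2 + i) ≡ f i) →
                     ∀ n → applyUpTo f n ≡ alternate (f 0) (f 1) n
applyUpTo-periodic f f-periodic zero    = refl
applyUpTo-periodic f f-periodic (suc n) = cong (f 0 ∷_) (begin
  applyUpTo (f ∘ suc) n           ≡⟨ applyUpTo-periodic (f ∘ suc) (f-periodic ∘ suc) n ⟩
  alternate (f 1) (f 2) n         ≡⟨ cong (λ z → alternate (f 1) z n) (f-periodic 0) ⟩
  alternate (f 1) (f 0) n         ∎)
  where open ≡-Reasoning

alternate⁺ : ∀ {A : Set} {P : A → Set} {x y} → P x → P y → ∀ n → All P (alternate x y n)
alternate⁺ px py zero    = []
alternate⁺ px py (suc n) = px ∷ alternate⁺ py px n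

countBy-alternate : ∀ a b n →
  countBy isPos (alternate (+ suc a) -[1+ b ] n) ≡ ⌈ n /2⌉ ×
  countBy isNeg (alternate (+ suc a) -[1+ b ] n) ≡ ⌊ n /2⌋
countBy-alternate a b 0 = refl , refl
countBy-alternate a b 1 = refl , refl
countBy-alternate a b (suc (suc n)) = Product.map (cong suc) (cong suc) (countBy-alternate a b n)

length-alternate : ∀ {A : Set} (x y : A) n → length (alternate x y n) ≡ n
length-alternate x y zero    = refl
length-alternate x y (suc n) = cong suc (length-alternate y x n)

map-applyUpTo : ∀ {A B : Set} (g : A → B) (f : ℕ → A) n → map g (applyUpTo f n) ≡ applyUpTo (g ∘ f) n
map-applyUpTo g f zero    = refl
map-applyUpTo g f (suc n) = cong (g (f 0) ∷_) (map-applyUpTo g (f ∘ suc) n)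

wOdd-alternate : ∀ r → wOdd (3 + r * 2) ≡ alternate (+ suc r) -[1+ suc r ] (3 + r * 2)
wOdd-alternate r = begin
  map g (upTo k)             ≡⟨ map-applyUpTo g (λ i → i) k ⟩
  applyUpTo g k              ≡⟨ applyUpTo-periodic g (λ _ → refl) k ⟩
  alternate (g 0) (g 1) k    ≡⟨ cong₂ (λ a b → alternate (+ a) (- (+ b)) k) g0 g1 ⟩
  alternate (+ suc r) -[1+ suc r ] k ∎
  where
  open ≡-Reasoning
  k = 3 + r * 2
  -- g is 2-periodic by computation: (2 + i) % 2 reduces to i % 2.
  g : ℕ → ℤ
  g i = if (i % 2) ≡ᵇ 0 then + ((k ∸ 1) / 2) else - (+ ((k + 1) / 2))
  g0 : (k ∸ 1) / 2 ≡ suc r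
  g0 = trans (n/2≡⌊n/2⌋ (2 + r * 2)) (cong suc (⌊n*2/2⌋≡n r))
  g1 : (k + 1) / 2 ≡ suc (suc r)
  g1 = trans (n/2≡⌊n/2⌋ (k + 1)) (trans (cong ⌊_/2⌋ (+-comm k 1)) (cong (suc ∘ suc) (⌊n*2/2⌋≡n r)))

skewBit : List ℤ → ℕ
skewBit u = if skewSymmetric? u then 1 else 0

skewBit-cong : ∀ {u v} → nonzeros u ≡ nonzeros v → skewBit u ≡ skewBit v
skewBit-cong e rewrite e = refl

skewBit-long : ∀ {u} → All (_≢ 0ℤ) u → 3 ≤ length u → skewBit u ≡ 0
skewBit-long {_ ∷ _ ∷ _ ∷ _} nz _ rewrite filter-all nonzero? nz = refl
skewBit-long {_ ∷ []}        _ (s≤s ())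
skewBit-long {_ ∷ _ ∷ []}    _ (s≤s (s≤s ()))

record IsWeight (k : ℕ) (ws : List ℤ) : Set where
  field
    length≡ : length ws ≡ k
    nonzero : All (_≢ 0ℤ) ws
    1≤#pos  : 1 ≤ countBy isPos ws
    1≤#neg  : 1 ≤ countBy isNeg ws
    halves  : skewBit ws + (⌊ countBy isPos ws /2⌋ + ⌊ countBy isNeg ws /2⌋) ≡ ⌊ k /2⌋
open IsWeight

isWeight-2 : IsWeight 2 (+ 1 ∷ - (+ 1) ∷ [])
isWeight-2 = record
  { length≡ = refl ; nonzero = (λ ()) ∷ (λ ()) ∷ [] ; 1≤#pos = s≤s z≤n ; 1≤#neg = s≤s z≤n ; halves = refl }

isWeight-4 : IsWeight 4 (+ 1 ∷ - (+ 1) ∷ - (+ 1) ∷ + 1 ∷ [])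
isWeight-4 = record
  { length≡ = refl ; nonzero = (λ ()) ∷ (λ ()) ∷ (λ ()) ∷ (λ ()) ∷ [] ; 1≤#pos = s≤s z≤n ; 1≤#neg = s≤s z≤n ; halves = refl }

isWeight-wOdd : ∀ r → IsWeight (3 + r * 2) (wOdd (3 + r * 2))
isWeight-wOdd r rewrite wOdd-alternate r = record
  { length≡ = length-alternate _ _ k
  ; nonzero = nz
  ; 1≤#pos  = subst (1 ≤_) (sym #pos) (s≤s z≤n)
  ; 1≤#neg  = subst (1 ≤_) (sym #neg) (s≤s z≤n)
  ; halves  = begin
      skewBit ws + (⌊ countBy isPos ws /2⌋ + ⌊ countBy isNeg ws /2⌋)
        ≡⟨ cong₂ _+_ (skewBit-long nz (s≤s (s≤s (s≤s z≤n)))) (cong₂ (λ p q → ⌊ p /2⌋ + ⌊ q /2⌋) #pos #neg) ⟩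
      suc (⌊ r /2⌋ + ⌈ r /2⌉) ≡⟨ cong suc (⌊n/2⌋+⌈n/2⌉≡n r) ⟩
      suc r                   ≡⟨ cong suc (⌈n*2/2⌉≡n r) ⟨
      ⌊ k /2⌋                 ∎ }
  where
  open ≡-Reasoning
  k = 3 + r * 2
  ws = alternate (+ suc r) -[1+ suc r ] k
  nz : All (_≢ 0ℤ) ws
  nz = alternate⁺ (λ ()) (λ ()) k
  #pos : countBy isPos ws ≡ 2 + r
  #pos = trans (proj₁ (countBy-alternate r (suc r) k)) (cong (suc ∘ suc) (⌊n*2/2⌋≡n r))
  #neg : countBy isNeg ws ≡ 1 + r
  #neg = trans (proj₂ (countBy-alternate r (suc r) k)) (cong suc (⌈n*2/2⌉≡n r))

isWeight-++ : ∀ {m ws} → 2 ≤ m → IsWeight m ws → IsWeight (m + m) (ws ++ ws)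
isWeight-++ {m} {ws} 2≤m W = record
  { length≡ = length-ws++ws
  ; nonzero = nz
  ; 1≤#pos  = subst (1 ≤_) (sym (countBy-++ isPos ws ws)) (≤-trans (1≤#pos W) (m≤m+n _ _))
  ; 1≤#neg  = subst (1 ≤_) (sym (countBy-++ isNeg ws ws)) (≤-trans (1≤#neg W) (m≤m+n _ _))
  ; halves  = begin
      skewBit (ws ++ ws) + (⌊ countBy isPos (ws ++ ws) /2⌋ + ⌊ countBy isNeg (ws ++ ws) /2⌋)
        ≡⟨ cong₂ _+_ (skewBit-long nz 3≤length)
                     (cong₂ (λ p q → ⌊ p /2⌋ + ⌊ q /2⌋) (countBy-++ isPos ws ws) (countBy-++ isNeg ws ws)) ⟩
      ⌊ p + p /2⌋ + ⌊ q + q /2⌋ ≡⟨ cong₂ _+_ (n≡⌊n+n/2⌋ p) (n≡⌊n+n/2⌋ q) ⟨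
      p + q                     ≡⟨ trans (countBy-isPos+isNeg (nonzero W)) (length≡ W) ⟩
      m                         ≡⟨ n≡⌊n+n/2⌋ m ⟩
      ⌊ m + m /2⌋               ∎ }
  where
  open ≡-Reasoning
  p = countBy isPos ws
  q = countBy isNeg ws
  nz : All (_≢ 0ℤ) (ws ++ ws)
  nz = ++⁺ (nonzero W) (nonzero W)
  length-ws++ws : length (ws ++ ws) ≡ m + m
  length-ws++ws = trans (length-++ ws) (cong₂ _+_ (length≡ W) (length≡ W))
  3≤length : 3 ≤ length (ws ++ ws)
  3≤length = subst (3 ≤_) (sym length-ws++ws) (≤-trans (n≤1+n 3) (+-mono-≤ 2≤m 2≤m))

data SizeView : ℕ → Set where
  two    : SizeView 2
  four   : SizeView 4
  odd    : ∀ r → SizeView (3 + r * 2)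
  double : ∀ r → SizeView ((3 + r) * 2)

sizeView : ∀ k → 2 ≤ k → SizeView k
sizeView 1 (s≤s ())
sizeView 2 _ = two
sizeView 3 _ = odd 0
sizeView (suc (suc k@(suc (suc _)))) _ with sizeView k (s≤s (s≤s z≤n))
... | two      = four
... | four     = double 0
... | odd r    = odd (suc r)
... | double r = double (suc r)

-- (3 + r * 2) % 2 and (1 + r * 2) % 2 have the same normal form.
wF-odd : ∀ f r → wF (suc f) (3 + r * 2) ≡ wOdd (3 + r * 2)
wF-odd f r rewrite [m+kn]%n≡m%n 1 r 2 ⦃ _ ⦄ = refl

wF-double : ∀ f r → wF (suc f) ((3 + r) * 2) ≡ wF f (3 + r) ++ wF f (3 + r)
wF-double f r rewrite m*n%n≡0 r 2 ⦃ _ ⦄ | n/2≡⌊n/2⌋ ((3 + r) * 2) | ⌊n*2/2⌋≡n r = refl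

isWeight-wF : ∀ f k → 2 ≤ k → k ≤ f → IsWeight k (wF f k)
isWeight-wF zero    k (s≤s (s≤s _)) ()
isWeight-wF (suc f) k 2≤k k≤1+f with sizeView k 2≤k
... | two                     = isWeight-2
... | four                    = isWeight-4
... | odd r rewrite wF-odd f r = isWeight-wOdd r
... | double r rewrite wF-double f r =
  subst (λ j → IsWeight j (wF f m ++ wF f m)) m+m≡m*2
        (isWeight-++ (s≤s (s≤s z≤n)) (isWeight-wF f m (s≤s (s≤s z≤n)) m≤f))
  where
  m = 3 + r
  m+m≡m*2 : m + m ≡ m * 2
  m+m≡m*2 = trans (cong (λ n → m + n) (sym (+-identityʳ m))) (*-comm 2 m)
  m≤f : m ≤ f
  m≤f = ≤-trans (+-monoʳ-≤ 3 (m≤m*n r 2)) (≤-trans (m≤n+m (3 + r * 2) 2) (s≤s⁻¹ k≤1+f))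

isWeight-w : ∀ k → 2 ≤ k → IsWeight k (w k)
isWeight-w k 2≤k = isWeight-wF k k 2≤k ≤-refl

-- The subtrees built by the local definitions left and right of build, which cannot be named here.
child : (ℤ → Bool) → ℕ → List ℤ → Maybe Tree
child P f u with 2 ≤ᵇ countBy P u
... | true  = just (build f (relabel P u (w (countBy P u))))
... | false = nothing

build-suc : ∀ f u → build (suc f) u ≡ node u (child isPos f u) (child isNeg f u)
build-suc f u with 2 ≤ᵇ countBy isPos u | 2 ≤ᵇ countBy isNeg u
... | true  | true  = refl
... | true  | false = refl
... | false | true  = refl
... | false | false = refl

skewVertices : List (List ℤ) → ℕ
skewVertices L = length (filter (λ u → skewSymmetric? u Bool.≟ true) L)

skewVertices-∷ : ∀ u L → skewVertices (u ∷ L) ≡ skewBit u + skewVertices L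
skewVertices-∷ u L with skewSymmetric? u
... | true  = refl
... | false = refl

skewVertices-++ : ∀ A B → skewVertices (A ++ B) ≡ skewVertices A + skewVertices B
skewVertices-++ A B = trans (cong length (filter-++ skew? A B)) (length-++ (filter skew? A))
  where skew? = λ u → skewSymmetric? u Bool.≟ true

record Tally (k : ℕ) (L : List (List ℤ)) : Set where
  constructor _,_
  field
    #vertices     : length L ≡ k ∸ 1
    #skewVertices : skewVertices L ≡ ⌊ k /2⌋
open Tally

tally-node : ∀ u {k p q A B} → 1 ≤ p → 1 ≤ q → p + q ≡ k →
             skewBit u + (⌊ p /2⌋ + ⌊ q /2⌋) ≡ ⌊ k /2⌋ →
             Tally p A → Tally q B → Tally k (u ∷ (A ++ B))
tally-node u {A = A} {B} (s≤s {n = p-1} _) (s≤s {n = q-1} _) refl halves (#A , skewA) (#B , skewB) =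
  (begin
    suc (length (A ++ B))   ≡⟨ cong suc (trans (length-++ A) (cong₂ _+_ #A #B)) ⟩
    suc (p-1 + q-1)         ≡⟨ +-suc p-1 q-1 ⟨
    p-1 + suc q-1           ∎)
  , (begin
    skewVertices (u ∷ (A ++ B))                ≡⟨ skewVertices-∷ u (A ++ B) ⟩
    skewBit u + skewVertices (A ++ B)          ≡⟨ cong (λ n → skewBit u + n) (trans (skewVertices-++ A B) (cong₂ _+_ skewA skewB)) ⟩
    skewBit u + (⌊ suc p-1 /2⌋ + ⌊ suc q-1 /2⌋) ≡⟨ halves ⟩
    ⌊ suc p-1 + suc q-1 /2⌋                   ∎)
  where open ≡-Reasoning

mutual
  tally-build : ∀ f k u → 2 ≤ k → k ≤ suc f → nonzeros u ≡ w k → Tally k (labels (build f u))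
  tally-build zero    k u (s≤s (s≤s _)) (s≤s ()) _
  tally-build (suc f) k u 2≤k k≤2+f u≈w =
    subst (Tally k ∘ labels) (sym (build-suc f u)) (tally-node u 1≤p 1≤q p+q≡k halves′
      (tally-child f isPos u 1≤p (<⇒≤pred (≤-trans p<k k≤2+f)))
      (tally-child f isNeg u 1≤q (<⇒≤pred (≤-trans q<k k≤2+f))))
    where
    W = isWeight-w k 2≤k
    p = countBy isPos u
    q = countBy isNeg u
    p≡ : p ≡ countBy isPos (w k)
    p≡ = trans (sym (countBy-nonzeros isPos refl u)) (cong (countBy isPos) u≈w)
    q≡ : q ≡ countBy isNeg (w k)
    q≡ = trans (sym (countBy-nonzeros isNeg refl u)) (cong (countBy isNeg) u≈w)
    1≤p : 1 ≤ p
    1≤p = subst (1 ≤_) (sym p≡) (1≤#pos W)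
    1≤q : 1 ≤ q
    1≤q = subst (1 ≤_) (sym q≡) (1≤#neg W)
    p+q≡k : p + q ≡ k
    p+q≡k = trans (cong₂ _+_ p≡ q≡) (trans (countBy-isPos+isNeg (nonzero W)) (length≡ W))
    p<k : p < k
    p<k = subst (p <_) p+q≡k (m<m+n p 1≤q)
    q<k : q < k
    q<k = subst (q <_) (trans (+-comm q p) p+q≡k) (m<m+n q 1≤p)
    halves′ : skewBit u + (⌊ p /2⌋ + ⌊ q /2⌋) ≡ ⌊ k /2⌋
    halves′ rewrite p≡ | q≡ | skewBit-cong {u} {w k} (trans u≈w (sym (filter-all nonzero? (nonzero W)))) = halves W

  tally-child : ∀ f P u → 1 ≤ countBy P u → countBy P u ≤ suc f → Tally (countBy P u) (labelsM (child P f u))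
  tally-child f P u 1≤c c≤1+f with 2 ≤ᵇ countBy P u in 2≤ᵇc
  ... | true  = tally-build f c (relabel P u (w c)) 2≤c c≤1+f (nonzeros-relabel P u (w c) (sym (length≡ Wc)) (nonzero Wc))
    where
    c = countBy P u
    2≤c = ≤ᵇ⇒≤ 2 c (subst True (sym 2≤ᵇc) tt)
    Wc = isWeight-w c 2≤c
  ... | false = subst (λ j → Tally j []) (sym c≡1) (refl , refl)
    where
    c≡1 : countBy P u ≡ 1
    c≡1 = ≤-antisym (s≤s⁻¹ (≰⇒> (λ 2≤c → subst True 2≤ᵇc (≤⇒≤ᵇ 2≤c)))) 1≤c

lemma3p1 : (n : ℕ) → 2 ≤ n →
    (vertices (T n) ≡ n ∸ 1) × (skewCount (T n) ≡ n / 2) × (symCount (T n) ≡ (n ∸ 1) / 2)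
lemma3p1 n@(suc r) 2≤n = #vertices tally , skews , syms
  where
  tally : Tally n (labels (T n))
  tally = tally-build n n (w n) 2≤n (n≤1+n n) (filter-all nonzero? (nonzero (isWeight-w n 2≤n)))
  skews : skewCount (T n) ≡ n / 2
  skews = trans (#skewVertices tally) (sym (n/2≡⌊n/2⌋ n))
  syms : symCount (T n) ≡ r / 2
  syms = trans (+-cancelʳ-≡ _ _ _ (begin
      symCount (T n) + skewCount (T n) ≡⟨ length-filter-false+true skewSymmetric? (labels (T n)) ⟩
      vertices (T n)                   ≡⟨ #vertices tally ⟩
      r                                ≡⟨ ⌊n/2⌋+⌈n/2⌉≡n r ⟨
      ⌊ r /2⌋ + ⌈ r /2⌉                ≡⟨ cong (λ m → ⌊ r /2⌋ + m) (#skewVertices tally) ⟨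
      ⌊ r /2⌋ + skewCount (T n)        ∎)) (sym (n/2≡⌊n/2⌋ r))
    where open ≡-Reasoning
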